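{- Let $\Delta<-4$ be a fundamental discriminant, written $\Delta=4m+\sigma$ with $\sigma\in\{0,1\}$. Let $n=dp$ with $d\ge 1$ an integer and $p$ an odd prime, and let $P=(A,B,C)\in\mathcal{S}_n(\mathbb{Z})$. If $P=\iota_{d\to n}(Q)$ for some $Q\in\mathcal{S}_d(\mathbb{Z})$, then for every prime $q$ dividing $A$ the integer $2B+\sigma C$ is a $p$-th power modulo $q$, i.e., $2B+\sigma C\equiv x^p \pmod q$ for some integer $x$.
   Context: Let $K=\mathbb{Q}(\sqrt{\Delta})$, $\mathcal{O}$ its ring of integers, $\omega=(\sigma+\sqrt{\Delta})/2$ (so $\mathcal{O}=\mathbb{Z}[\omega]$), and $Q_0(x,y)=x^2+\sigma xy-my^2=N(x+y\omega)$ the principal form. For an integer $r\ge 2$, $\mathcal{S}_r(\mathbb{Z})$ is the set of integer triples $(A,B,C)$ with $Q_0(B,C)=A^r$ and $\gcd(B,C)=1$; $\mathcal{S}_1(\mathbb{Z})$ is the set of integer triples $(A,B,C)$ with $Q_0(B,C)=A$, $\gcd(B,C)=1$ and $\gcd(A,\Delta)=1$. For $d\mid n$ with $k=n/d$, the map $\iota_{d\to n}:\mathcal{S}_d(\mathbb{Z})\to\mathcal{S}_n(\mathbb{Z})$ sends $(A,b,c)$ to $(A,B',C')$, where the integers $B',C'$ are defined by $B'+C'\omega=(b+c\omega)^k$. -}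

module Defs where

open import Data.Nat as ℕ using (ℕ; suc)
open import Data.Integer using (ℤ; +_; _+_; _*_; -_; _^_; _-_)
open import Data.Integer.Divisibility using (_∣_)
open import Data.Integer.GCD using (gcd)
open import Data.Product using (_×_; _,_; ∃; ∃-syntax)
open import Data.Sum using (_⊎_)
open import Relation.Binary.PropositionalEquality using (_≡_)

-- x is squarefree: no square of a natural number other than 1 divides x
-- (so 0 is not squarefree).
SquareFree : ℤ → Set
SquareFree x = ∀ (k : ℕ) → (+ k * + k) ∣ x → k ≡ 1

-- Fundamental discriminant (Δ = 1 excluded separately by Δ < -4 in the statement):
-- Δ ≡ 1 (mod 4) squarefree, or Δ = 4k with k ≡ 2,3 (mod 4) and k squarefree.
FundamentalDiscriminant : ℤ → Set
FundamentalDiscriminant Δ =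
  (∃[ j ] (Δ ≡ + 4 * j + + 1) × SquareFree Δ)
  ⊎ (∃[ k ] (Δ ≡ + 4 * k) × (∃[ j ] (k ≡ + 4 * j + + 2 ⊎ k ≡ + 4 * j + + 3)) × SquareFree k)

-- Elements x + yω of ℤ[ω] as pairs (x , y), where ω² = σω + m
-- (ω = (σ + √Δ)/2, Δ = 4m + σ).
mulω : (σ m : ℤ) → ℤ × ℤ → ℤ × ℤ → ℤ × ℤ
mulω σ m (a , b) (c , d) = (a * c + m * (b * d)) , (a * d + b * c + σ * (b * d))

powω : (σ m : ℤ) → ℤ × ℤ → ℕ → ℤ × ℤ
powω σ m z ℕ.zero = (+ 1 , + 0)
powω σ m z (suc k) = mulω σ m z (powω σ m z k)

-- principal form Q₀(x,y) = x² + σxy − my² = N(x + yω)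
Q₀ : (σ m : ℤ) → ℤ → ℤ → ℤ
Q₀ σ m x y = x * x + σ * x * y - m * (y * y)

InS : (Δ σ m : ℤ) → ℕ → ℤ × ℤ × ℤ → Set
InS Δ σ m r (A , B , C) =
  (Q₀ σ m B C ≡ A ^ r) × (gcd B C ≡ + 1) × (r ≡ 1 → gcd A Δ ≡ + 1)

-- ι_{d→n}(A,b,c) = (A,B',C') with B' + C'ω = (b + cω)^k, k = n/d
ι : (σ m : ℤ) → (k : ℕ) → ℤ × ℤ × ℤ → ℤ × ℤ × ℤ
ι σ m k (A , b , c) with powω σ m (b , c) k
... | (B' , C') = (A , B' , C')

{-# OPTIONS --safe #-}
-- Write α = b + cω for the ℤ[ω]-element underlying Q, so that (A , B , C) = ι(Q) gives
-- B + Cω = αᵖ and 2B + σC = tr(αᵖ), where tr(x + yω) = 2x + σy. Since N(α) = Aᵈ, the prime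
-- q divides N(α). The Cayley–Hamilton relation α² = tr(α)α − N(α) yields the recurrence
-- tr(α^(k+2)) = tr(α) tr(α^(k+1)) − N(α) tr(αᵏ), hence tr(αᵏ) ≡ tr(α)ᵏ (mod N(α)) for k ≥ 1,
-- and x = tr(α) = 2b + σc is the required p-th root. Of the hypotheses on d and p only
-- d ≥ 1 and p ≥ 1 matter.
module Submission where

open import Defs
open import Data.Nat as ℕ using (ℕ)
open import Data.Nat.Primality using (Prime)
open import Data.Integer using (ℤ; +_; _+_; _*_; -_; _^_; _-_; _<_)
open import Data.Integer.Divisibility using (_∣_)
open import Data.Product using (_×_; _,_; ∃; ∃-syntax)
open import Data.Sum using (_⊎_)
open import Relation.Binary.PropositionalEquality using (_≡_; _≢_; refl; sym; subst)

open import Data.Integer.Tactic.RingSolver using (solve-∀)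
import Data.Integer.Divisibility.Signed as Signed

trace : ℤ → ℤ × ℤ → ℤ
trace σ (x , y) = + 2 * x + σ * y

norm : (σ m : ℤ) → ℤ × ℤ → ℤ
norm σ m (x , y) = Q₀ σ m x y

trace-mulω-one : ∀ σ m α → trace σ (mulω σ m α (+ 1 , + 0)) ≡ trace σ α
trace-mulω-one σ m (b , c) = identity σ m b c
  where
  identity : ∀ σ m b c →
    + 2 * (b * + 1 + m * (c * + 0)) + σ * (b * + 0 + c * + 1 + σ * (c * + 0)) ≡ + 2 * b + σ * c
  identity = solve-∀

trace-mulω-mulω : ∀ σ m α β →
  trace σ (mulω σ m α (mulω σ m α β))
    ≡ trace σ α * trace σ (mulω σ m α β) - norm σ m α * trace σ β
trace-mulω-mulω σ m (b , c) (x , y) = identity σ m b c x y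
  where
  -- spelt out because the ring solver does not unfold trace and mulω
  identity : ∀ σ m b c x y →
    + 2 * (b * (b * x + m * (c * y)) + m * (c * (b * y + c * x + σ * (c * y))))
      + σ * (b * (b * y + c * x + σ * (c * y)) + c * (b * x + m * (c * y))
             + σ * (c * (b * y + c * x + σ * (c * y))))
    ≡ (+ 2 * b + σ * c) * (+ 2 * (b * x + m * (c * y)) + σ * (b * y + c * x + σ * (c * y)))
      - (b * b + σ * b * c - m * (c * c)) * (+ 2 * x + σ * y)
  identity = solve-∀

a≡tu-nv⇒a-tw≡t[u-w]-nv : ∀ {a} t u n v w → a ≡ t * u - n * v → a - t * w ≡ t * (u - w) - n * v
a≡tu-nv⇒a-tw≡t[u-w]-nv t u n v w refl = identity t u n v w
  where
  identity : ∀ t u n v w → t * u - n * v - t * w ≡ t * (u - w) - n * v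
  identity = solve-∀

trace-powω-≡-trace^ : ∀ {q} σ m α k → q Signed.∣ norm σ m α →
  q Signed.∣ trace σ (powω σ m α (ℕ.suc k)) - trace σ α ^ ℕ.suc k
trace-powω-≡-trace^ {q} σ m α ℕ.zero _ rewrite trace-mulω-one σ m α =
  Signed.divides (+ 0) (identity (trace σ α) q)
  where
  identity : ∀ t q → t - t * + 1 ≡ + 0 * q
  identity = solve-∀
trace-powω-≡-trace^ {q} σ m α (ℕ.suc k) q∣N =
  subst (q Signed.∣_) (sym recurrence)
    (Signed.∣m∣n⇒∣m-n (Signed.∣n⇒∣m*n t (trace-powω-≡-trace^ σ m α k q∣N))
                      (Signed.∣m⇒∣m*n (trace σ αᵏ) q∣N))
  where
  t : ℤ
  t = trace σ α
  αᵏ : ℤ × ℤ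
  αᵏ = powω σ m α k

  recurrence : trace σ (powω σ m α (ℕ.suc (ℕ.suc k))) - t ^ ℕ.suc (ℕ.suc k)
             ≡ t * (trace σ (powω σ m α (ℕ.suc k)) - t ^ ℕ.suc k) - norm σ m α * trace σ αᵏ
  recurrence = a≡tu-nv⇒a-tw≡t[u-w]-nv t (trace σ (powω σ m α (ℕ.suc k))) (norm σ m α) (trace σ αᵏ)
                 (t ^ ℕ.suc k) (trace-mulω-mulω σ m α αᵏ)

proposition4 : (Δ m σ : ℤ) → FundamentalDiscriminant Δ → Δ < - + 4
    → Δ ≡ + 4 * m + σ → (σ ≡ + 0 ⊎ σ ≡ + 1)
    → (d p n : ℕ) → 1 ℕ.≤ d → Prime p → p ≢ 2 → n ≡ d ℕ.* p
    → (A B C : ℤ) → InS Δ σ m n (A , B , C)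
    → (∃[ Q ] (InS Δ σ m d Q × ι σ m p Q ≡ (A , B , C)))
    → (q : ℕ) → Prime q → (+ q) ∣ A
    → ∃[ x ] ((+ q) ∣ ((+ 2 * B + σ * C) - x ^ p))
proposition4 Δ m σ _ _ _ _ (ℕ.suc d) (ℕ.suc p) n _ _ _ _ A B C _
             ((.A , b , c) , (norm≡Aᵈ , _ , _) , refl) q _ q∣A =
  trace σ (b , c) , Signed.∣⇒∣ᵤ (trace-powω-≡-trace^ σ m (b , c) p q∣norm)
  where
  q∣norm : + q Signed.∣ norm σ m (b , c)
  q∣norm = subst (+ q Signed.∣_) (sym norm≡Aᵈ) (Signed.∣m⇒∣m*n {m = A} (A ^ d) (Signed.∣ᵤ⇒∣ q∣A))
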